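{- The simple terms of $\mathcal{T}$ are exactly the terms generated by the grammar $t ::= \mathtt{C}\,t \mid (t_1,\dots,t_n)\ (n>0) \mid \vec d \mid \langle w\rangle\vec d$, $\quad\vec d ::= () \mid \vec{d_v}$, $\quad\vec{d_v} ::= \mathtt{x} \mid \pi_i\vec{d_v} \mid \overline{\mathtt{C}}\,\vec{d_v}$, where $\mathtt{x}$ ranges over variables, $\mathtt{C}$ over constructors, $i\ge 1$, $w\in\mathbb{Z}_\infty$, and $()$ is the empty tuple.
   Context: Let $\mathbb{Z}_\infty=\mathbb{Z}\cup\{\infty\}$, with $\infty+n=n+\infty=\infty+\infty=\infty$. The set $\mathcal{T}$ of terms is generated by $t ::= \mathtt{x} \mid \mathtt{C}\,t \mid (t_1,\dots,t_n) \mid \overline{\mathtt{C}}\,t \mid \pi_i t \mid t_1+t_2 \mid \mathbf{0} \mid \langle w\rangle t$ ($\mathtt{x}$ a variable, $\mathtt{C}$ a constructor name, $n\ge0$, $i\ge1$, $w\in\mathbb{Z}_\infty$), quotiented by: every term former ($\mathtt{C}\,\cdot$, $\overline{\mathtt{C}}\,\cdot$, $\pi_i\cdot$, $\langle w\rangle\cdot$, each tuple component) sends $\mathbf{0}$ to $\mathbf{0}$ and distributes over $+$; $+$ is associative, commutative, idempotent with neutral $\mathbf{0}$. The reduction $\to$ is the contextual closure of: $\overline{\mathtt{C}}\,\mathtt{C}\,t\to t$; $\pi_i(t_1,\dots,t_n)\to t_i$ ($1\le i\le n$); $\langle w\rangle\mathtt{C}\,t\to\langle w+1\rangle t$; $\langle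 w\rangle(t_1,\dots,t_n)\to\sum_{i}\langle w+1\rangle t_i$ ($n>0$); $\overline{\mathtt{C}}\langle w\rangle t\to\langle w-1\rangle t$; $\pi_i\langle w\rangle t\to\langle w-1\rangle t$; $\langle w\rangle\langle v\rangle t\to\langle w+v\rangle t$; $\pi_i\,\mathtt{C}\,t\to\mathbf{0}$; $\pi_i(t_1,\dots,t_n)\to\mathbf{0}$ ($i>n$); $\overline{\mathtt{C}}(t_1,\dots,t_n)\to\mathbf{0}$; $\overline{\mathtt{C}}\,\mathtt{D}\,t\to\mathbf{0}$ ($\mathtt{C}\ne\mathtt{D}$). A term is simple if it is in normal form for $\to$ and contains neither $+$ nor $\mathbf{0}$. -}

module Defs where

open import Data.Nat using (ℕ; zero; suc; _<_; _≥_)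
open import Data.Integer as ℤ using (ℤ)
open import Data.List using (List; []; _∷_; length)
open import Data.List.Relation.Unary.All using (All)
open import Data.Product using (Σ; ∃; _×_)
open import Relation.Nullary using (¬_)
open import Relation.Binary.PropositionalEquality using (_≡_; _≢_)

data ℤ∞ : Set where
  fin : ℤ → ℤ∞
  ∞   : ℤ∞

infixl 6 _+∞_
_+∞_ : ℤ∞ → ℤ∞ → ℤ∞
fin a +∞ fin b = fin (a ℤ.+ b)
fin _ +∞ ∞     = ∞
∞     +∞ _     = ∞

suc∞ : ℤ∞ → ℤ∞
suc∞ w = w +∞ fin (ℤ.+ 1)

pred∞ : ℤ∞ → ℤ∞
pred∞ w = w +∞ fin (ℤ.- (ℤ.+ 1))

-- Raw terms over a set V of variables and a set C of constructor names.
-- NOTE: (proj k t) stands for π_(k+1) t, so that the index i = k+1 ≥ 1.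
data Term (V C : Set) : Set where
  var  : V → Term V C
  con  : C → Term V C → Term V C
  tup  : List (Term V C) → Term V C
  des  : C → Term V C → Term V C
  proj : ℕ → Term V C → Term V C
  _⊕_  : Term V C → Term V C → Term V C
  𝟘    : Term V C
  wt   : ℤ∞ → Term V C → Term V C

module _ {V C : Set} where

  data _[_]≔_ : List (Term V C) → ℕ → Term V C → Set where
    here  : ∀ {t ts} → (t ∷ ts) [ zero ]≔ t
    there : ∀ {s ts k t} → ts [ k ]≔ t → (s ∷ ts) [ suc k ]≔ t

  sumWt : ℤ∞ → Term V C → List (Term V C) → Term V C
  sumWt w t []        = wt (suc∞ w) t
  sumWt w t (s ∷ ts)  = wt (suc∞ w) t ⊕ sumWt w s ts

  data _↦_ : Term V C → Term V C → Set where
    des-con     : ∀ {c t} → des c (con c t) ↦ t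
    proj-tup    : ∀ {k ts t} → ts [ k ]≔ t → proj k (tup ts) ↦ t
    wt-con      : ∀ {w c t} → wt w (con c t) ↦ wt (suc∞ w) t
    wt-tup      : ∀ {w t ts} → wt w (tup (t ∷ ts)) ↦ sumWt w t ts
    des-wt      : ∀ {c w t} → des c (wt w t) ↦ wt (pred∞ w) t
    proj-wt     : ∀ {k w t} → proj k (wt w t) ↦ wt (pred∞ w) t
    wt-wt       : ∀ {w v t} → wt w (wt v t) ↦ wt (w +∞ v) t
    proj-con    : ∀ {k c t} → proj k (con c t) ↦ 𝟘
    proj-tup-out : ∀ {k ts} → k ≥ length ts → proj k (tup ts) ↦ 𝟘
    des-tup     : ∀ {c ts} → des c (tup ts) ↦ 𝟘
    des-con≢    : ∀ {c d t} → c ≢ d → des c (con d t) ↦ 𝟘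

  infix 4 _⟶_ _⟶ₗ_
  mutual
    data _⟶_ : Term V C → Term V C → Set where
      root  : ∀ {t u} → t ↦ u → t ⟶ u
      ctx-con  : ∀ {c t u} → t ⟶ u → con c t ⟶ con c u
      ctx-tup  : ∀ {ts us} → ts ⟶ₗ us → tup ts ⟶ tup us
      ctx-des  : ∀ {c t u} → t ⟶ u → des c t ⟶ des c u
      ctx-proj : ∀ {k t u} → t ⟶ u → proj k t ⟶ proj k u
      ctx-⊕ˡ   : ∀ {t u s} → t ⟶ u → (t ⊕ s) ⟶ (u ⊕ s)
      ctx-⊕ʳ   : ∀ {t u s} → t ⟶ u → (s ⊕ t) ⟶ (s ⊕ u)
      ctx-wt   : ∀ {w t u} → t ⟶ u → wt w t ⟶ wt w u

    data _⟶ₗ_ : List (Term V C) → List (Term V C) → Set where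
      hd : ∀ {t u ts} → t ⟶ u → (t ∷ ts) ⟶ₗ (u ∷ ts)
      tl : ∀ {t ts us} → ts ⟶ₗ us → (t ∷ ts) ⟶ₗ (t ∷ us)

  NormalForm : Term V C → Set
  NormalForm t = ∀ u → ¬ (t ⟶ u)

  data Pure : Term V C → Set where
    var  : ∀ {x} → Pure (var x)
    con  : ∀ {c t} → Pure t → Pure (con c t)
    tup  : ∀ {ts} → All Pure ts → Pure (tup ts)
    des  : ∀ {c t} → Pure t → Pure (des c t)
    proj : ∀ {k t} → Pure t → Pure (proj k t)
    wt   : ∀ {w t} → Pure t → Pure (wt w t)

  Simple : Term V C → Set
  Simple t = Pure t × NormalForm t

  data IsDv : Term V C → Set where
    var  : ∀ {x} → IsDv (var x)
    proj : ∀ {k t} → IsDv t → IsDv (proj k t)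
    des  : ∀ {c t} → IsDv t → IsDv (des c t)

  data IsD : Term V C → Set where
    unit : IsD (tup [])
    dv   : ∀ {t} → IsDv t → IsD t

  data IsGen : Term V C → Set where
    con : ∀ {c t} → IsGen t → IsGen (con c t)
    tup : ∀ {t ts} → All IsGen (t ∷ ts) → IsGen (tup (t ∷ ts))
    d   : ∀ {t} → IsD t → IsGen t
    wt  : ∀ {w t} → IsD t → IsGen (wt w t)

-- By induction on a simple term: its immediate subterms are simple, hence generated.
-- Below C̄, πᵢ or ⟨w⟩ a generated term that is not a destructor chain d_v (or, under
-- ⟨w⟩, the empty tuple) creates a root redex.  Conversely, every rule needs a
-- constructor, tuple or weight directly under a destructor or weight, which the
-- grammar never produces.
module Submission where

open import Defs
open import Data.Product using (_×_; _,_; ∃)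
open import Data.Nat using (zero; suc; _<_; s≤s)
open import Data.Nat.Properties using (_<?_; ≮⇒≥)
open import Data.List using (List; []; _∷_; length)
open import Data.List.Relation.Unary.All using (All; []; _∷_)
open import Data.Empty using (⊥-elim)
open import Relation.Nullary using (¬_; yes; no)
open import Relation.Binary.PropositionalEquality using (refl)

module _ {V C : Set} where

  private variable
    t  : Term V C
    ts : List (Term V C)

  normal-under : (f : Term V C → Term V C) → (∀ {t u} → t ⟶ u → f t ⟶ f u) →
                 NormalForm (f t) → NormalForm t
  normal-under f ctx nf u r = nf _ (ctx r)

  normal-tup⁻¹ : NormalForm (tup ts) → All NormalForm ts
  normal-tup⁻¹ {[]}     nf = []
  normal-tup⁻¹ {t ∷ ts} nf = (λ u r → nf _ (ctx-tup (hd r))) ∷ normal-tup⁻¹ normal-tail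
    where
    normal-tail : NormalForm (tup ts)
    normal-tail _ (ctx-tup r) = nf _ (ctx-tup (tl r))
    normal-tail _ (root ())

  lookup-< : ∀ (ts : List (Term V C)) {k} → k < length ts → ∃ (ts [ k ]≔_)
  lookup-< (t ∷ ts) {zero}  _       = t , here
  lookup-< (t ∷ ts) {suc k} (s≤s p) with lookup-< ts p
  ... | u , q = u , there q

  proj-tup-not-normal : ∀ {k} ts → ¬ NormalForm (proj k (tup ts))
  proj-tup-not-normal {k} ts nf with k <? length ts
  ... | yes k<n = let u , ts[k]≔u = lookup-< ts k<n in nf u (root (proj-tup ts[k]≔u))
  ... | no  k≮n = nf 𝟘 (root (proj-tup-out (≮⇒≥ k≮n)))

  -- No decidable equality on constructor names is needed: if c ≡ e then des-con fires,
  -- and that is exactly the hypothesis refuted to fire des-con≢.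
  des-con-not-normal : ∀ {c e} {t : Term V C} → ¬ NormalForm (des c (con e t))
  des-con-not-normal {t = t} nf = nf 𝟘 (root (des-con≢ λ { refl → nf t (root des-con) }))

  dv-under-des : ∀ {c} → IsGen t → NormalForm (des c t) → IsDv t
  dv-under-des (con _)      nf = ⊥-elim (des-con-not-normal nf)
  dv-under-des (tup _)      nf = ⊥-elim (nf _ (root des-tup))
  dv-under-des (d unit)     nf = ⊥-elim (nf _ (root des-tup))
  dv-under-des (d (dv t∈d)) _  = t∈d
  dv-under-des (wt _)       nf = ⊥-elim (nf _ (root des-wt))

  dv-under-proj : ∀ {k} → IsGen t → NormalForm (proj k t) → IsDv t
  dv-under-proj (con _)      nf = ⊥-elim (nf _ (root proj-con))
  dv-under-proj (tup _)      nf = ⊥-elim (proj-tup-not-normal _ nf)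
  dv-under-proj (d unit)     nf = ⊥-elim (proj-tup-not-normal [] nf)
  dv-under-proj (d (dv t∈d)) _  = t∈d
  dv-under-proj (wt _)       nf = ⊥-elim (nf _ (root proj-wt))

  d-under-wt : ∀ {w} → IsGen t → NormalForm (wt w t) → IsD t
  d-under-wt (con _) nf = ⊥-elim (nf _ (root wt-con))
  d-under-wt (tup _) nf = ⊥-elim (nf _ (root wt-tup))
  d-under-wt (d t∈d) _  = t∈d
  d-under-wt (wt _)  nf = ⊥-elim (nf _ (root wt-wt))

  mutual
    simple⇒IsGen : Pure t → NormalForm t → IsGen t
    simple⇒IsGen var         _  = d (dv var)
    simple⇒IsGen (con p)     nf = con (simple⇒IsGen p (normal-under (con _) ctx-con nf))
    simple⇒IsGen (tup {[]} _) _  = d unit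
    simple⇒IsGen (tup {_ ∷ _} ps) nf = tup (simple⇒IsGen-All ps (normal-tup⁻¹ nf))
    simple⇒IsGen (des p)     nf =
      d (dv (des (dv-under-des (simple⇒IsGen p (normal-under (des _) ctx-des nf)) nf)))
    simple⇒IsGen (proj p)    nf =
      d (dv (proj (dv-under-proj (simple⇒IsGen p (normal-under (proj _) ctx-proj nf)) nf)))
    simple⇒IsGen (wt p)      nf =
      wt (d-under-wt (simple⇒IsGen p (normal-under (wt _) ctx-wt nf)) nf)

    simple⇒IsGen-All : All Pure ts → All NormalForm ts → All IsGen ts
    simple⇒IsGen-All []       []         = []
    simple⇒IsGen-All (p ∷ ps) (nf ∷ nfs) = simple⇒IsGen p nf ∷ simple⇒IsGen-All ps nfs

  IsDv⇒Pure : IsDv t → Pure t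
  IsDv⇒Pure var      = var
  IsDv⇒Pure (proj t) = proj (IsDv⇒Pure t)
  IsDv⇒Pure (des t)  = des (IsDv⇒Pure t)

  IsD⇒Pure : IsD t → Pure t
  IsD⇒Pure unit   = tup []
  IsD⇒Pure (dv t) = IsDv⇒Pure t

  mutual
    IsGen⇒Pure : IsGen t → Pure t
    IsGen⇒Pure (con t)  = con (IsGen⇒Pure t)
    IsGen⇒Pure (tup ts) = tup (IsGen⇒Pure-All ts)
    IsGen⇒Pure (d t)    = IsD⇒Pure t
    IsGen⇒Pure (wt t)   = wt (IsD⇒Pure t)

    IsGen⇒Pure-All : All IsGen ts → All Pure ts
    IsGen⇒Pure-All []       = []
    IsGen⇒Pure-All (t ∷ ts) = IsGen⇒Pure t ∷ IsGen⇒Pure-All ts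

  IsDv⇒NormalForm : IsDv t → NormalForm t
  IsDv⇒NormalForm var       _ (root ())
  IsDv⇒NormalForm (proj t)  _ (ctx-proj r) = IsDv⇒NormalForm t _ r
  IsDv⇒NormalForm (proj ()) _ (root (proj-tup _))
  IsDv⇒NormalForm (proj ()) _ (root proj-wt)
  IsDv⇒NormalForm (proj ()) _ (root proj-con)
  IsDv⇒NormalForm (proj ()) _ (root (proj-tup-out _))
  IsDv⇒NormalForm (des t)   _ (ctx-des r) = IsDv⇒NormalForm t _ r
  IsDv⇒NormalForm (des ())  _ (root des-con)
  IsDv⇒NormalForm (des ())  _ (root des-wt)
  IsDv⇒NormalForm (des ())  _ (root des-tup)
  IsDv⇒NormalForm (des ())  _ (root (des-con≢ _))

  IsD⇒NormalForm : IsD t → NormalForm t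
  IsD⇒NormalForm unit   _ (root ())
  IsD⇒NormalForm unit   _ (ctx-tup ())
  IsD⇒NormalForm (dv t) = IsDv⇒NormalForm t

  mutual
    IsGen⇒NormalForm : IsGen t → NormalForm t
    IsGen⇒NormalForm (con t)  _ (root ())
    IsGen⇒NormalForm (con t)  _ (ctx-con r) = IsGen⇒NormalForm t _ r
    IsGen⇒NormalForm (tup ts) _ (root ())
    IsGen⇒NormalForm (tup ts) _ (ctx-tup r) = IsGen-All⇒irreducible ts _ r
    IsGen⇒NormalForm (d t)    = IsD⇒NormalForm t
    IsGen⇒NormalForm (wt t)   _ (ctx-wt r) = IsD⇒NormalForm t _ r
    IsGen⇒NormalForm (wt (dv ())) _ (root wt-con)
    IsGen⇒NormalForm (wt (dv ())) _ (root wt-tup)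
    IsGen⇒NormalForm (wt (dv ())) _ (root wt-wt)

    IsGen-All⇒irreducible : All IsGen ts → ∀ us → ¬ (ts ⟶ₗ us)
    IsGen-All⇒irreducible (t ∷ _)  _ (hd r) = IsGen⇒NormalForm t _ r
    IsGen-All⇒irreducible (_ ∷ ts) _ (tl r) = IsGen-All⇒irreducible ts _ r

  IsGen⇒Simple : IsGen t → Simple t
  IsGen⇒Simple t = IsGen⇒Pure t , IsGen⇒NormalForm t

lemma1p5 : {V C : Set} (t : Term V C) → (Simple t → IsGen t) × (IsGen t → Simple t)
lemma1p5 t = (λ (p , nf) → simple⇒IsGen p nf) , IsGen⇒Simple
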